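{- Let $m\ge1$. A binary tree $T$ is an $m$-binary tree if and only if its size equals $n\cdot m$ for some $n\ge0$ and its binary-search-tree labelling satisfies, for every $j=1,\dots,n$, $$jm\triangleleft_T jm-1\triangleleft_T\cdots\triangleleft_T (j-1)m+1 .$$
   Context: A binary tree is empty or a root with ordered (left, right) subtrees; size = number of nodes; a tree of size $N$ is labelled by $1,\dots,N$ as a binary search tree (labels in the left subtree of a node are smaller, in the right subtree larger), and $a\triangleleft_T b$ means that $a$ lies in the subtree rooted at $b$. $m$-binary trees are defined recursively: the empty tree is $m$-binary; given $m$-binary trees $T_L,T_{R_1},\dots,T_{R_m}$ and $m$ new nodes $r_1,\dots,r_m$, the following tree is $m$-binary: $r_1$ is the root with left subtree $T_L$; for $1\le i<m$, the right subtree of $r_i$ is $T_{R_i}$ with $r_{i+1}$ grafted as the left child of the leftmost node of $T_{R_i}$ (if $T_{R_i}$ is empty, $r_{i+1}$ is the right child of $r_i$); the right subtree of $r_m$ is $T_{R_m}$. -}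

module Defs where

open import Data.Nat using (ℕ; zero; suc; _+_; _*_; _≤_; _<_)
open import Data.Vec using (Vec; []; _∷_)
open import Data.Vec.Relation.Unary.All using (All)

data Tree : Set where
  leaf : Tree
  node : Tree → Tree → Tree

size : Tree → ℕ
size leaf       = 0
size (node l r) = suc (size l + size r)

-- graft t T : t grafted as the left child of the leftmost node of T;
-- if T is empty the result is t itself (so that in the parent it becomes
-- the right child, as in the paper).
graft : Tree → Tree → Tree
graft t leaf       = t
graft t (node l r) = node (graft t l) r

-- block TL (R₁ ∷ … ∷ Rₘ): the tree with root r₁ (left subtree TL), where
-- the right subtree of rᵢ is T_{Rᵢ} with r_{i+1} grafted at its leftmost
-- node (i < m), and the right subtree of rₘ is T_{Rₘ}.  For i ≥ 2 the left
-- subtree of rᵢ is empty.  (The case m = 0 is never used since m ≥ 1.)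
block : {m : ℕ} → Tree → Vec Tree m → Tree
block TL []             = TL
block TL (R ∷ [])       = node TL R
block TL (R ∷ R′ ∷ Rs)  = node TL (graft (block leaf (R′ ∷ Rs)) R)

data MBinary (m : ℕ) : Tree → Set where
  mb-leaf : MBinary m leaf
  mb-node : (TL : Tree) (Rs : Vec Tree m) →
            MBinary m TL → All (MBinary m) Rs →
            MBinary m (block TL Rs)

-- Binary-search-tree labelling by 1..N (in-order), with an offset o:
-- the nodes of T get labels o+1, …, o+size T.
-- Desc o T a b  ⇔  (in T labelled from o+1) a lies in the subtree rooted at b.
data Desc (o : ℕ) : Tree → ℕ → ℕ → Set where
  here  : ∀ {l r a} → o < a → a ≤ o + size (node l r) →
          Desc o (node l r) a (suc (o + size l))
  left  : ∀ {l r a b} → Desc o l a b → Desc o (node l r) a b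
  right : ∀ {l r a b} → Desc (suc (o + size l)) r a b → Desc o (node l r) a b

_◁[_]_ : ℕ → Tree → ℕ → Set
a ◁[ T ] b = Desc 0 T a b

-- In the in-order labelling, a + 1 lies in the subtree of a exactly when node a has a
-- nonempty right subtree (a + 1 is then the leftmost node of that subtree).  So the chain
-- condition says that the in-order sequence of flags "has a nonempty right subtree" is a
-- concatenation of blocks true^(m-1) b.  Grafting concatenates flag sequences, and the
-- m new nodes r₁, …, rₘ of the recursive construction contribute exactly one such block
-- (m - 1 trues, then the flag of rₘ).  Conversely, a flag sequence of this shape is cut
-- after the left subtree of the root (its rightmost node has flag false, so a block ends
-- there) and then along the leftmost nodes of the successive right subtrees, recovering
-- r₁, …, rₘ; the pieces are m-binary by induction on size.
module Submission where

open import Defs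
open import Data.Bool using (Bool; true; false)
open import Data.Empty using (⊥-elim)
open import Data.List using (List; []; _∷_; _++_; length; take; drop)
open import Data.List.Properties using (++-assoc; ++-identityʳ; length-++; length-take; length-drop; take++drop≡id)
open import Data.Nat using (ℕ; zero; suc; _+_; _*_; _∸_; _≤_; _<_; z≤n; s≤s)
open import Data.Nat.Properties
open import Data.Nat.Induction using (<-wellFounded)
open import Data.Product using (∃-syntax; _×_; _,_)
open import Data.Sum using (_⊎_; inj₁; inj₂)
open import Data.Vec using (Vec; []; _∷_)
open import Data.Vec.Relation.Unary.All using (All; []; _∷_)
open import Function.Bundles using (_⇔_; mk⇔; Equivalence)
import Function.Properties.Equivalence as ⇔
open import Induction.WellFounded using (Acc; acc)
open import Relation.Binary.PropositionalEquality

variable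
  k n o p s t : ℕ
  b : Bool
  xs ys : List Bool
  l r L R T X Y : Tree

isNode : Tree → Bool
isNode leaf       = false
isNode (node _ _) = true

rightFlags : Tree → List Bool
rightFlags leaf       = []
rightFlags (node l r) = rightFlags l ++ isNode r ∷ rightFlags r

length-rightFlags : ∀ T → length (rightFlags T) ≡ size T
length-rightFlags leaf       = refl
length-rightFlags (node l r) = begin
  length (rightFlags l ++ isNode r ∷ rightFlags r)  ≡⟨ length-++ (rightFlags l) ⟩
  length (rightFlags l) + suc (length (rightFlags r)) ≡⟨ cong₂ (λ a c → a + suc c) (length-rightFlags l) (length-rightFlags r) ⟩
  size l + suc (size r)                              ≡⟨ +-suc (size l) (size r) ⟩
  suc (size l + size r)                              ∎
  where open ≡-Reasoning

size-graft : ∀ t Y → size (graft t Y) ≡ size t + size Y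
size-graft t leaf       = sym (+-identityʳ (size t))
size-graft t (node l r) = begin
  suc (size (graft t l) + size r) ≡⟨ cong (λ a → suc (a + size r)) (size-graft t l) ⟩
  suc (size t + size l + size r)  ≡⟨ cong suc (+-assoc (size t) (size l) (size r)) ⟩
  suc (size t + (size l + size r)) ≡⟨ +-suc (size t) _ ⟨
  size t + size (node l r)        ∎
  where open ≡-Reasoning

rightFlags-graft : ∀ t Y → rightFlags (graft t Y) ≡ rightFlags t ++ rightFlags Y
rightFlags-graft t leaf       = sym (++-identityʳ (rightFlags t))
rightFlags-graft t (node l r) =
  trans (cong (_++ _) (rightFlags-graft t l)) (++-assoc (rightFlags t) (rightFlags l) _)

-- Positions are 0-based; out-of-range positions read as false.
_at_ : List Bool → ℕ → Bool
[]       at _     = false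
(x ∷ _)  at zero  = x
(_ ∷ xs) at suc p = xs at p

at-++ˡ : ∀ xs → xs at p ≡ true → (xs ++ ys) at p ≡ true
at-++ˡ {zero}  (x ∷ xs) x≡ = x≡
at-++ˡ {suc p} (x ∷ xs) f  = at-++ˡ xs f

at-++ʳ : ∀ xs p → (xs ++ ys) at (length xs + p) ≡ ys at p
at-++ʳ []       p = refl
at-++ʳ (x ∷ xs) p = at-++ʳ xs p

at-++-∷ : ∀ xs p {y} → (xs ++ y ∷ ys) at p ≡ true →
          xs at p ≡ true ⊎ (p ≡ length xs × y ≡ true) ⊎ ∃[ q ] (p ≡ length xs + suc q × ys at q ≡ true)
at-++-∷ []       zero    y≡ = inj₂ (inj₁ (refl , y≡))
at-++-∷ []       (suc q) f  = inj₂ (inj₂ (q , refl , f))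
at-++-∷ (x ∷ xs) zero    x≡ = inj₁ x≡
at-++-∷ (x ∷ xs) (suc p) f with at-++-∷ xs p f
... | inj₁ f′                  = inj₁ f′
... | inj₂ (inj₁ (p≡ , y≡))     = inj₂ (inj₁ (cong suc p≡ , y≡))
... | inj₂ (inj₂ (q , p≡ , f′)) = inj₂ (inj₂ (q , cong suc p≡ , f′))

at-take : ∀ n xs → p < n → take n xs at p ≡ xs at p
at-take (suc n) []       _         = refl
at-take (suc n) (x ∷ xs) (s≤s z≤n) = refl
at-take (suc n) (x ∷ xs) (s≤s (s≤s p<n)) = at-take n xs (s≤s p<n)

at-drop : ∀ n xs → drop n xs at p ≡ xs at (n + p)
at-drop zero    xs       = refl
at-drop (suc n) []       = refl
at-drop (suc n) (x ∷ xs) = at-drop n xs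

root-offset : ∀ o m n → o + suc (m + n) ≡ suc (o + m) + n
root-offset o m n = trans (+-suc o (m + n)) (cong suc (sym (+-assoc o m n)))

desc-root-succ : p ≡ size l → isNode r ≡ true → Desc o (node l r) (suc (o + suc p)) (o + suc p)
desc-root-succ {l = l} {r = node r₁ r₂} {o = o} refl refl rewrite +-suc o (size l) =
  here (s≤s (≤-trans (m≤m+n o (size l)) (n≤1+n _)))
       (subst (suc (suc (o + size l)) ≤_) (sym (root-offset o (size l) (size (node r₁ r₂))))
              (m<m+n (suc (o + size l)) (s≤s z≤n)))

flag⇒desc : ∀ o T p → rightFlags T at p ≡ true → Desc o T (suc (o + suc p)) (o + suc p)
flag⇒desc o (node l r) p f with at-++-∷ (rightFlags l) p f
... | inj₁ f′ = left (flag⇒desc o l p f′)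
... | inj₂ (inj₁ (p≡ , r≡)) = desc-root-succ (trans p≡ (length-rightFlags l)) r≡
... | inj₂ (inj₂ (q , p≡ , f′)) rewrite trans p≡ (cong (_+ suc q) (length-rightFlags l)) =
  subst (λ a → Desc o (node l r) (suc a) a) (sym (root-offset o (size l) (suc q)))
        (right (flag⇒desc (suc (o + size l)) r q f′))

desc⇒flag : ∀ {a} → Desc o T (suc a) a → ∃[ p ] (a ≡ o + suc p × rightFlags T at p ≡ true)
desc⇒flag {o} (here {l} {leaf} _ a≤) =
  ⊥-elim (1+n≰n (≤-trans a≤ (≤-reflexive (trans (root-offset o (size l) 0) (+-identityʳ _)))))
desc⇒flag {o} (here {l} {node _ _} _ _) =
  size l , sym (+-suc o (size l)) ,
  subst (λ q → (rightFlags l ++ _) at q ≡ true) (trans (+-identityʳ _) (length-rightFlags l)) (at-++ʳ (rightFlags l) 0)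
desc⇒flag (left {l} d) with desc⇒flag d
... | p , a≡ , f = p , a≡ , at-++ˡ (rightFlags l) f
desc⇒flag {o} (right {l} {r} d) with desc⇒flag d
... | q , a≡ , f =
  size l + suc q , trans a≡ (sym (root-offset o (size l) (suc q))) ,
  subst (λ n → (rightFlags l ++ isNode r ∷ rightFlags r) at (n + suc q) ≡ true) (length-rightFlags l)
        (trans (at-++ʳ (rightFlags l) (suc q)) f)

link⇔flag : ∀ T a i → (a + suc (suc i)) ◁[ T ] (a + suc i) ⇔ rightFlags T at (a + i) ≡ true
link⇔flag T a i rewrite +-suc a (suc i) | +-suc a i = mk⇔ to (flag⇒desc 0 T (a + i))
  where
  to : suc (suc (a + i)) ◁[ T ] suc (a + i) → rightFlags T at (a + i) ≡ true
  to d with desc⇒flag d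
  ... | p , a≡ , f = subst (λ q → rightFlags T at q ≡ true) (sym (suc-injective a≡)) f

-- The automaton recognising (true^k · any bit)^*: in state s it still expects s trues
-- before the free last bit of the current block; k is the block boundary.
data Run (k : ℕ) : ℕ → List Bool → ℕ → Set where
  done   : Run k s [] s
  forced : Run k s xs t → Run k (suc s) (true ∷ xs) t
  free   : Run k k xs t → Run k 0 (b ∷ xs) t

Blocked : ℕ → List Bool → Set
Blocked k xs = Run k k xs k

run-++ : Run k s xs t → Run k t ys n → Run k s (xs ++ ys) n
run-++ done         run′ = run′
run-++ (forced run) run′ = forced (run-++ run run′)
run-++ (free run)   run′ = free (run-++ run run′)

run-split : ∀ xs → Run k s (xs ++ ys) n → ∃[ t ] (Run k s xs t × Run k t ys n)
run-split []       run          = _ , done , run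
run-split (x ∷ xs) (forced run) with run-split xs run
... | t , run₁ , run₂ = t , forced run₁ , run₂
run-split (x ∷ xs) (free run)   with run-split xs run
... | t , run₁ , run₂ = t , free run₁ , run₂

-- The rightmost node of a tree has flag false, so reading its flags ends at a boundary.
mutual
  run-node-ends : ∀ l r → Run k s (rightFlags (node l r)) t → t ≡ k
  run-node-ends l r run with run-split (rightFlags l) run
  ... | _ , _ , run′ = run-rightmost r run′

  run-rightmost : ∀ r → Run k s (isNode r ∷ rightFlags r) t → t ≡ k
  run-rightmost leaf       (free done)   = refl
  run-rightmost (node l r) (forced run) = run-node-ends l r run
  run-rightmost (node l r) (free run)   = run-node-ends l r run

run-split-node : ∀ l r → Run k s (rightFlags (node l r) ++ ys) n →
                 Run k s (rightFlags (node l r)) k × Run k k ys n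
run-split-node l r run with run-split (rightFlags (node l r)) run
... | _ , run₁ , run₂ with run-node-ends l r run₁
... | refl = run₁ , run₂

run-split-tree : ∀ T → Run k k (rightFlags T ++ ys) n → Blocked k (rightFlags T) × Run k k ys n
run-split-tree leaf       run = done , run
run-split-tree (node l r) run = run-split-node l r run

Aligned : ℕ → List Bool → Set
Aligned k xs =
  ∃[ n ] (length xs ≡ n * suc k × (∀ j i → j < n → i < k → xs at (j * suc k + i) ≡ true))

-- Started in state s, the p-th bit of xs sits at position k ∸ s + p of the block grid;
-- the shifted equations below say this without truncated subtraction.
run⇒shifted-aligned :
  Run k s xs k →
  ∃[ n ] (k + length xs ≡ s + n * suc k ×
          (∀ j i p → j < n → i < k → k + p ≡ s + (j * suc k + i) → xs at p ≡ true))
run⇒shifted-aligned done = 0 , refl , λ _ _ _ ()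
run⇒shifted-aligned {k} (forced {s} {xs} run) with run⇒shifted-aligned run
... | n , len , al = n , trans (+-suc k (length xs)) (cong suc len) , al′
  where
  al′ : ∀ j i p → j < n → i < k → k + p ≡ suc s + (j * suc k + i) → (true ∷ xs) at p ≡ true
  al′ j i zero    _   _   _  = refl
  al′ j i (suc p) j<n i<k eq = al j i p j<n i<k (suc-injective (trans (sym (+-suc k p)) eq))
run⇒shifted-aligned {k} (free {xs} {b = b} run) with run⇒shifted-aligned run
... | n , len , al = suc n , trans (+-suc k (length xs)) (cong suc len) , al′
  where
  al′ : ∀ j i p → j < suc n → i < k → k + p ≡ j * suc k + i → (b ∷ xs) at p ≡ true
  al′ zero    i p _         i<k eq = ⊥-elim (<⇒≱ i<k (subst (k ≤_) eq (m≤m+n k p)))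
  al′ (suc j) i p (s≤s j<n) i<k eq with +-cancelˡ-≡ k p (suc (j * suc k + i))
      (trans eq (trans (cong suc (+-assoc k (j * suc k) i)) (sym (+-suc k _))))
  ... | refl = al j i _ j<n i<k refl

run⇒aligned : Blocked k xs → Aligned k xs
run⇒aligned {k} run with run⇒shifted-aligned run
... | n , len , al = n , +-cancelˡ-≡ k _ _ len , λ j i j<n i<k → al j i _ j<n i<k refl

prefix⇒run : ∀ s ys → length ys ≡ suc s → (∀ i → i < s → ys at i ≡ true) → Run k s ys k
prefix⇒run zero    (_ ∷ [])    _   _    = free done
prefix⇒run zero    (_ ∷ _ ∷ _) ()  _
prefix⇒run (suc s) (y ∷ ys)    len tr with tr 0 (s≤s z≤n)
... | refl = forced (prefix⇒run s ys (suc-injective len) (λ i i<s → tr (suc i) (s≤s i<s)))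

aligned⇒run : ∀ n xs → length xs ≡ n * suc k →
              (∀ j i → j < n → i < k → xs at (j * suc k + i) ≡ true) → Blocked k xs
aligned⇒run zero    []       _   _  = done
aligned⇒run {k} (suc n) xs len al =
  subst (Blocked k) (take++drop≡id (suc k) xs) (run-++ firstBlock rest)
  where
  firstBlock : Run k k (take (suc k) xs) k
  firstBlock = prefix⇒run k (take (suc k) xs)
    (trans (length-take (suc k) xs) (m≤n⇒m⊓n≡m (subst (suc k ≤_) (sym len) (m≤m+n (suc k) _))))
    (λ i i<k → trans (at-take (suc k) xs (m<n⇒m<1+n i<k)) (al 0 i (s≤s z≤n) i<k))
  rest : Blocked k (drop (suc k) xs)
  rest = aligned⇒run n (drop (suc k) xs)
    (trans (length-drop (suc k) xs) (trans (cong (_∸ suc k) len) (m+n∸m≡n (suc k) _)))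
    (λ j i j<n i<k → trans (at-drop (suc k) xs)
       (trans (cong (xs at_) (sym (+-assoc (suc k) (j * suc k) i))) (al (suc j) i (s≤s j<n) i<k)))

blocked⇔aligned : Blocked k xs ⇔ Aligned k xs
blocked⇔aligned = mk⇔ run⇒aligned (λ (n , len , al) → aligned⇒run n _ len al)

rightFlags-block : ∀ TL R (Rs : Vec Tree p) →
  rightFlags (block TL (R ∷ Rs)) ≡ rightFlags TL ++ rightFlags (block leaf (R ∷ Rs))
rightFlags-block TL R []      = refl
rightFlags-block TL R (_ ∷ _) = refl

rightFlags-graft-node : ∀ l r Y →
  rightFlags (node leaf (graft (node l r) Y)) ≡ true ∷ rightFlags (node l r) ++ rightFlags Y
rightFlags-graft-node l r leaf       = cong (true ∷_) (rightFlags-graft (node l r) leaf)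
rightFlags-graft-node l r Y@(node _ _) = cong (true ∷_) (rightFlags-graft (node l r) Y)

rightFlags-block-leaf : ∀ R R′ (Rs : Vec Tree p) →
  rightFlags (block leaf (R ∷ R′ ∷ Rs)) ≡ true ∷ rightFlags (block leaf (R′ ∷ Rs)) ++ rightFlags R
rightFlags-block-leaf R R′ []      = rightFlags-graft-node leaf R′ R
rightFlags-block-leaf R R′ (_ ∷ _) = rightFlags-graft-node leaf _ R

mutual
  mbinary⇒blocked : MBinary (suc k) T → Blocked k (rightFlags T)
  mbinary⇒blocked mb-leaf = done
  mbinary⇒blocked {k} (mb-node TL (R ∷ Rs) mTL mRs) =
    subst (λ xs → Run k k xs k) (sym (rightFlags-block TL R Rs))
          (run-++ (mbinary⇒blocked mTL) (run-block-leaf mRs))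

  run-block-leaf : {Rs : Vec Tree (suc p)} → All (MBinary (suc k)) Rs → Run k p (rightFlags (block leaf Rs)) k
  run-block-leaf (mR ∷ []) = free (mbinary⇒blocked mR)
  run-block-leaf {p} {k} {R ∷ R′ ∷ Rs} (mR ∷ mRs) =
    subst (λ xs → Run k p xs k) (sym (rightFlags-block-leaf R R′ Rs))
          (forced (run-++ (run-block-leaf mRs) (mbinary⇒blocked mR)))

data Leftmost : Tree → Set where
  empty    : Leftmost leaf
  leftmost : ∀ X Y → Leftmost (graft (node leaf X) Y)

leftmost? : ∀ T → Leftmost T
leftmost? leaf = empty
leftmost? (node l r) with leftmost? l
... | empty        = leftmost r leaf
... | leftmost X Y = leftmost X (node Y r)

-- T is the right subtree of some rᵢ in the recursive construction of a (k+1)-binary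
-- tree, with s + 1 nodes r_{i+1}, …, rₘ still to come.
data Grafted (k s : ℕ) : Tree → Set where
  grafted : ∀ {Rs : Vec Tree (suc s)} {Y} → All (MBinary (suc k)) Rs → MBinary (suc k) Y →
            Grafted k s (graft (block leaf Rs) Y)

mutual
  blocked⇒mbinary : Acc _<_ (size T) → Blocked k (rightFlags T) → MBinary (suc k) T
  blocked⇒mbinary {leaf}     _         _   = mb-leaf
  blocked⇒mbinary {node L R} (acc rec) run with run-split-tree L run
  ... | runL , runR =
    run⇒mbinary-node (blocked⇒mbinary (rec (s≤s (m≤m+n (size L) (size R)))) runL)
                     (rec (s≤s (m≤n+m (size R) (size L)))) runR

  run⇒mbinary-node : MBinary (suc k) L → Acc _<_ (size R) → Run k k (b ∷ rightFlags R) k →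
                     MBinary (suc k) (node L R)
  run⇒mbinary-node mL ac (free run) = mb-node _ (_ ∷ []) mL (blocked⇒mbinary ac run ∷ [])
  run⇒mbinary-node {k = suc k} mL ac (forced run) with run⇒grafted ac (n<1+n k) run
  ... | grafted {Rs = _ ∷ _} {Y = Y} mRs mY = mb-node _ (Y ∷ _) mL (mY ∷ mRs)

  run⇒grafted : Acc _<_ (size T) → s < k → Run k s (rightFlags T) k → Grafted k s T
  run⇒grafted {T} ac s<k run with leftmost? T
  run⇒grafted ac s<k done | empty = ⊥-elim (<-irrefl refl s<k)
  run⇒grafted {s = s} {k} (acc rec) s<k run | leftmost X Y
    with run-split-node leaf X (subst (λ xs → Run k s xs k) (rightFlags-graft (node leaf X) Y) run)
  ... | runX , runY =
    run⇒grafted-leftmost (rec (subst (size X <_) size≡ (m≤m+n (suc (size X)) (size Y))))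
                         (rec (subst (size Y <_) size≡ (m<n+m (size Y) (s≤s z≤n)))) s<k runX runY
    where
    size≡ : suc (size X) + size Y ≡ size (graft (node leaf X) Y)
    size≡ = sym (size-graft (node leaf X) Y)

  run⇒grafted-leftmost : Acc _<_ (size X) → Acc _<_ (size Y) → s < k →
                         Run k s (b ∷ rightFlags X) k → Blocked k (rightFlags Y) →
                         Grafted k s (graft (node leaf X) Y)
  run⇒grafted-leftmost acX acY _ (free runX) runY =
    grafted (blocked⇒mbinary acX runX ∷ []) (blocked⇒mbinary acY runY)
  run⇒grafted-leftmost acX acY s<k (forced runX) runY with run⇒grafted acX (<⇒≤ s<k) runX
  ... | grafted {Rs = _ ∷ _} {Y = Y′} mRs mY′ = grafted (mY′ ∷ mRs) (blocked⇒mbinary acY runY)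

mbinary⇔blocked : ∀ T → MBinary (suc k) T ⇔ Blocked k (rightFlags T)
mbinary⇔blocked T = mk⇔ mbinary⇒blocked (blocked⇒mbinary (<-wellFounded (size T)))

aligned⇔links : ∀ k T →
  Aligned k (rightFlags T) ⇔
    (∃[ n ] (size T ≡ n * suc k ×
      (∀ j i → j < n → 1 ≤ i → i < suc k → (j * suc k + suc i) ◁[ T ] (j * suc k + i))))
aligned⇔links k T = mk⇔
  (λ (n , len , al) → n , trans (sym (length-rightFlags T)) len , λ where
    j (suc i) j<n _ (s≤s i<k) → Equivalence.from (link⇔flag T (j * suc k) i) (al j i j<n i<k))
  (λ (n , size≡ , links) → n , trans (length-rightFlags T) size≡ , λ j i j<n i<k →
    Equivalence.to (link⇔flag T (j * suc k) i) (links j (suc i) j<n (s≤s z≤n) (s≤s i<k)))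

proposition8p1p5 : (m : ℕ) → 1 ≤ m → (T : Tree) →
    MBinary m T ⇔
      (∃[ n ] (size T ≡ n * m ×
        (∀ j i → j < n → 1 ≤ i → i < m →
          (j * m + suc i) ◁[ T ] (j * m + i))))
proposition8p1p5 (suc k) _ T =
  ⇔.trans (mbinary⇔blocked T) (⇔.trans blocked⇔aligned (aligned⇔links k T))
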